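{- Let $R$ be a Riesz space with strong unit and $I$ an integral on $R$. Then $\mu_I(D(a)):=\sup\{I(na^+\wedge1):n\in\mathbb{N}\}$ defines a valuation on $\mathrm{Spec}(R)$.
   Context: A Riesz space is a $\mathbb{Q}$-vector space with a compatible lattice order; $1$ is a strong unit if every $x$ satisfies $-n1\le x\le n1$ for some $n$; $a^+=a\vee0$. $\mathrm{Spec}(R)$ is the distributive lattice generated by symbols $D(a)$, $a\in R$, subject to $D(1)=1$, $D(a)\wedge D(-a)=0$, $D(a+b)\le D(a)\vee D(b)$, $D(a)=0$ if $a\le0$, $D(a\vee b)=D(a)\vee D(b)$ (every element is of the form $D(a)$). An integral is a linear map $I:R\to\mathbb{R}$ (Dedekind reals) with $I(x)\ge0$ for $x\ge0$ and $I(1)=1$. Lower reals are inhabited, downward closed, open subsets of $\mathbb{Q}$; suprema of inhabited families of lower reals are lower reals. A valuation is a map $\mu$ from $\mathrm{Spec}(R)$ to nonnegative lower reals with $\mu(0)=0$, $\mu(1)=1$, $\mu(x)+\mu(y)=\mu(x\vee y)+\mu(x\wedge y)$, $\mu(x)\le\mu(y)$ when $x\le y$, and $\mu(D(a))\le\sup_{\varepsilon>0}\mu(D(a-\varepsilon))$ ($\varepsilon$ rational). -}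

module Defs where

open import Level using (Level; _⊔_; 0ℓ) renaming (suc to lsuc)
open import Data.Nat using (ℕ)
open import Data.Integer using (+_)
open import Data.Rational using (ℚ; 0ℚ; 1ℚ; _<_; _≤_; _+_; _*_; _⊓_; _/_)
open import Data.Rational.Properties using (+-*-ring)
open import Data.Product using (∃; ∃-syntax; _×_)
open import Data.Sum using (_⊎_)
open import Data.Empty using (⊥)
open import Function.Bundles using (_⇔_)
open import Relation.Binary.Core using (Rel)
open import Relation.Binary.Lattice.Structures using (IsLattice)
open import Algebra.Module.Bundles using (LeftModule)

ℕ→ℚ : ℕ → ℚ
ℕ→ℚ n = (+ n) / 1

Cut : Set₁
Cut = ℚ → Set

infix 4 _≐_ _⊆_
_≐_ : Cut → Cut → Set
P ≐ Q = ∀ q → P q ⇔ Q q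

_⊆_ : Cut → Cut → Set
P ⊆ Q = ∀ q → P q → Q q

below : ℚ → Cut
below q = λ p → p < q

infixl 6 _+ᶜ_
_+ᶜ_ : Cut → Cut → Cut
(P +ᶜ Q) p = ∃[ r ] ∃[ s ] (P r × Q s × p < r + s)

record ℝ : Set₁ where
  field
    L U          : Cut
    L-inhabited  : ∃ L
    U-inhabited  : ∃ U
    L-rounded    : ∀ q → L q ⇔ (∃[ r ] (q < r × L r))
    U-rounded    : ∀ q → U q ⇔ (∃[ r ] (r < q × U r))
    disjoint     : ∀ q → L q → U q → ⊥
    located      : ∀ {q r} → q < r → L q ⊎ U r
open ℝ public

-- lower cut of q · x for a rational q and a Dedekind real x
-- (for q ≥ 0 it is q·L(x), for q < 0 it is q·U(x))
scale : ℚ → ℝ → Cut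
scale q x p = ∃[ r ] ∃[ s ] (L x r × U x s × p < (q * r) ⊓ (q * s))

record LowerReal : Set₁ where
  field
    cut        : Cut
    inhabited  : ∃ cut
    downClosed : ∀ {p q} → p ≤ q → cut q → cut p
    roundedUp  : ∀ {p} → cut p → ∃[ q ] (p < q × cut q)
open LowerReal public

record RieszSpace (c ℓ₁ ℓ₂ : Level) : Set (lsuc (c ⊔ ℓ₁ ⊔ ℓ₂)) where
  field
    vectorSpace : LeftModule +-*-ring c ℓ₁
  open LeftModule vectorSpace public
  infix 4 _≤ᴿ_
  field
    _≤ᴿ_      : Rel Carrierᴹ ℓ₂
    _∨_ _∧_   : Carrierᴹ → Carrierᴹ → Carrierᴹ
    isLattice : IsLattice _≈ᴹ_ _≤ᴿ_ _∨_ _∧_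
    +-mono    : ∀ {x y} z → x ≤ᴿ y → x +ᴹ z ≤ᴿ y +ᴹ z
    *-nonneg  : ∀ {q x} → 0ℚ ≤ q → 0ᴹ ≤ᴿ x → 0ᴹ ≤ᴿ q *ₗ x
    1ᴿ         : Carrierᴹ
    strongUnit : ∀ x → ∃[ n ] (-ᴹ (ℕ→ℚ n *ₗ 1ᴿ) ≤ᴿ x × x ≤ᴿ ℕ→ℚ n *ₗ 1ᴿ)

  _⁺ : Carrierᴹ → Carrierᴹ
  x ⁺ = x ∨ 0ᴹ

  _-ᴹ_ : Carrierᴹ → Carrierᴹ → Carrierᴹ
  x -ᴹ y = x +ᴹ (-ᴹ y)

module _ {c ℓ₁ ℓ₂ : Level} (R : RieszSpace c ℓ₁ ℓ₂) where
  open RieszSpace R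

  -- Spec(R): the distributive lattice presented by generators D(a) and
  -- the relations of the paper. Equality in Spec(R) is x ⊑ y and y ⊑ x.

  infixr 6 _⋁_
  infixr 7 _⋀_
  data SpecTerm : Set c where
    D       : Carrierᴹ → SpecTerm
    ⊤ˢ ⊥ˢ   : SpecTerm
    _⋁_ _⋀_ : SpecTerm → SpecTerm → SpecTerm

  infix 4 _⊑_
  data _⊑_ : SpecTerm → SpecTerm → Set (c ⊔ ℓ₁ ⊔ ℓ₂) where
    ⊑-refl  : ∀ {x} → x ⊑ x
    ⊑-trans : ∀ {x y z} → x ⊑ y → y ⊑ z → x ⊑ z
    ⊥-min   : ∀ {x} → ⊥ˢ ⊑ x
    ⊤-max   : ∀ {x} → x ⊑ ⊤ˢ
    ⋁-inl   : ∀ {x y} → x ⊑ x ⋁ y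
    ⋁-inr   : ∀ {x y} → y ⊑ x ⋁ y
    ⋁-lub   : ∀ {x y z} → x ⊑ z → y ⊑ z → x ⋁ y ⊑ z
    ⋀-prl   : ∀ {x y} → x ⋀ y ⊑ x
    ⋀-prr   : ∀ {x y} → x ⋀ y ⊑ y
    ⋀-glb   : ∀ {x y z} → z ⊑ x → z ⊑ y → z ⊑ x ⋀ y
    distrib : ∀ {x y z} → x ⋀ (y ⋁ z) ⊑ (x ⋀ y) ⋁ (x ⋀ z)
    -- generators are indexed by elements of the set R (respect ≈)
    D-cong   : ∀ {a b} → a ≈ᴹ b → D a ⊑ D b
    D-one    : ⊤ˢ ⊑ D 1ᴿ
    D-neg    : ∀ {a} → D a ⋀ D (-ᴹ a) ⊑ ⊥ˢ
    D-add    : ∀ {a b} → D (a +ᴹ b) ⊑ D a ⋁ D b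
    D-nonpos : ∀ {a} → a ≤ᴿ 0ᴹ → D a ⊑ ⊥ˢ
    D-join₁  : ∀ {a b} → D (a ∨ b) ⊑ D a ⋁ D b
    D-join₂  : ∀ {a b} → D a ⋁ D b ⊑ D (a ∨ b)

  -- Integrals (equalities of Dedekind reals are expressed via lower cuts)

  record Integral : Set (lsuc 0ℓ ⊔ c ⊔ ℓ₁ ⊔ ℓ₂) where
    field
      I           : Carrierᴹ → ℝ
      I-cong      : ∀ {a b} → a ≈ᴹ b → L (I a) ≐ L (I b)
      additive    : ∀ a b → L (I (a +ᴹ b)) ≐ L (I a) +ᶜ L (I b)
      homogeneous : ∀ q a → L (I (q *ₗ a)) ≐ scale q (I a)
      positive    : ∀ x → 0ᴹ ≤ᴿ x → ∀ q → U (I x) q → 0ℚ ≤ q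
      unital      : L (I 1ᴿ) ≐ below 1ℚ

  record Valuation : Set (lsuc 0ℓ ⊔ c ⊔ ℓ₁ ⊔ ℓ₂) where
    field
      μ          : SpecTerm → LowerReal
      nonneg     : ∀ x → below 0ℚ ⊆ cut (μ x)
      μ-⊥        : cut (μ ⊥ˢ) ≐ below 0ℚ
      μ-⊤        : cut (μ ⊤ˢ) ≐ below 1ℚ
      modular    : ∀ x y → cut (μ x) +ᶜ cut (μ y) ≐ cut (μ (x ⋁ y)) +ᶜ cut (μ (x ⋀ y))
      monotone   : ∀ {x y} → x ⊑ y → cut (μ x) ⊆ cut (μ y)
      continuous : ∀ a → cut (μ (D a))
                     ⊆ (λ p → ∃[ ε ] (0ℚ < ε × cut (μ (D (a -ᴹ (ε *ₗ 1ᴿ)))) p))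

  μI : Integral → Carrierᴹ → Cut
  μI 𝓘 a p = ∃[ n ] L (Integral.I 𝓘 ((ℕ→ℚ n *ₗ (a ⁺)) ∧ 1ᴿ)) p

-- Interpret a lattice term t of Spec(R) in R (D a ↦ a, ⋁ ↦ ∨, ⋀ ↦ ∧, ⊤ ↦ 1, ⊥ ↦ 0) and let
-- μ(t) = sup_n I(n⟦t⟧⁺ ∧ 1). The defining relations of Spec(R) do not hold in R as inequalities,
-- but they do hold up to domination: x ≼ y when every truncation n x⁺ ∧ 1 lies below some
-- multiple of y⁺ (for instance (a + b)⁺ ≤ 2 (a ∨ b)⁺ and a ∧ -a ≤ 0), and μ is monotone along ≼.
-- Modularity is the identity (u ∨ v) + (u ∧ v) = u + v for the truncations of a and b at a
-- common level, combined with additivity of I. For continuity, n(a - ε)⁺ ∧ 1 falls short of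
-- n a⁺ ∧ 1 by at most nε·1, whose integral is below nε; so ε is chosen with nε smaller than
-- the slack between a rational in μ(D a) and a larger one.
module Submission where

open import Level using (Level)
open import Data.Nat as ℕ using (ℕ; zero; suc)
import Data.Nat.Properties as ℕ
import Data.Nat.Coprimality as Coprimality
open import Data.Integer as ℤ using (+_)
import Data.Integer.Properties as ℤ
open import Data.Rational as ℚ using (ℚ; 0ℚ; 1ℚ; mkℚ; Positive; NonNegative)
import Data.Rational.Properties as ℚ
open import Data.Rational.Solver using (module +-*-Solver)
open import Data.Product using (Σ-syntax; ∃-syntax; _×_; _,_)
open import Data.Sum using (inj₁; inj₂)
open import Data.Empty using (⊥-elim)
open import Function.Base using (id)
open import Function.Bundles using (mk⇔; Equivalence)
open import Relation.Binary.PropositionalEquality using (_≡_; refl; sym; trans; cong; cong₂; subst; subst₂)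
open import Relation.Binary.Lattice.Bundles using (Lattice)
import Relation.Binary.Lattice.Properties.JoinSemilattice as JoinProperties
import Relation.Binary.Lattice.Properties.MeetSemilattice as MeetProperties
import Relation.Binary.Reasoning.PartialOrder as ≤-Reasoning
import Algebra.Properties.Group as GroupProperties

open import Defs

ℕ→ℚ≡mkℚ : ∀ n → ℕ→ℚ n ≡ mkℚ (+ n) 0 (Coprimality.sym (Coprimality.1-coprimeTo n))
ℕ→ℚ≡mkℚ n = ℚ.↥p/↧p≡p _

ℕ→ℚ-homo-+ : ∀ m n → ℕ→ℚ (m ℕ.+ n) ≡ ℕ→ℚ m ℚ.+ ℕ→ℚ n
ℕ→ℚ-homo-+ m n rewrite ℕ→ℚ≡mkℚ m | ℕ→ℚ≡mkℚ n =
  ℚ./-cong (trans (ℤ.pos-+ m n) (sym (cong₂ ℤ._+_ (ℤ.*-identityʳ (+ m)) (ℤ.*-identityʳ (+ n))))) refl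

ℕ→ℚ-nonNeg : ∀ n → NonNegative (ℕ→ℚ n)
ℕ→ℚ-nonNeg n = ℚ.normalize-nonNeg n 1

ℕ→ℚ-suc-pos : ∀ n → Positive (ℕ→ℚ (suc n))
ℕ→ℚ-suc-pos n = ℚ.normalize-pos (suc n) 1

0≤ℕ→ℚ : ∀ n → 0ℚ ℚ.≤ ℕ→ℚ n
0≤ℕ→ℚ n = ℚ.nonNegative⁻¹ (ℕ→ℚ n) {{ℕ→ℚ-nonNeg n}}

0≤ℕ→ℚ* : ∀ n {ε} → 0ℚ ℚ.≤ ε → 0ℚ ℚ.≤ ℕ→ℚ n ℚ.* ε
0≤ℕ→ℚ* n {ε} 0≤ε = ℚ.nonNegative⁻¹ _ {{ℚ.nonNeg*nonNeg⇒nonNeg (ℕ→ℚ n) {{ℕ→ℚ-nonNeg n}} ε {{ℚ.nonNegative 0≤ε}}}}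

ℕ→ℚ-mono-≤ : ∀ {m n} → m ℕ.≤ n → ℕ→ℚ m ℚ.≤ ℕ→ℚ n
ℕ→ℚ-mono-≤ {m} {n} m≤n = subst (λ k → ℕ→ℚ m ℚ.≤ ℕ→ℚ k) (ℕ.m+[n∸m]≡n m≤n) (begin
  ℕ→ℚ m                      ≡⟨ ℚ.+-identityʳ (ℕ→ℚ m) ⟨
  ℕ→ℚ m ℚ.+ 0ℚ               ≤⟨ ℚ.+-monoʳ-≤ (ℕ→ℚ m) (0≤ℕ→ℚ (n ℕ.∸ m)) ⟩
  ℕ→ℚ m ℚ.+ ℕ→ℚ (n ℕ.∸ m)    ≡⟨ ℕ→ℚ-homo-+ m (n ℕ.∸ m) ⟨
  ℕ→ℚ (m ℕ.+ (n ℕ.∸ m))      ∎)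
  where open ℚ.≤-Reasoning

+-cancelʳ-< : ∀ {p q} r → p ℚ.+ r ℚ.< q ℚ.+ r → p ℚ.< q
+-cancelʳ-< {p} {q} r p+r<q+r = subst₂ ℚ._<_ (cancel p) (cancel q) (ℚ.+-monoˡ-< (ℚ.- r) p+r<q+r)
  where
  open +-*-Solver
  cancel : ∀ x → x ℚ.+ r ℚ.- r ≡ x
  cancel x = solve 2 (λ x r → x :+ r :- r := x) refl x r

∃-ℕ-multiple-below : ∀ n {p q} → p ℚ.< q → ∃[ ε ] (0ℚ ℚ.< ε × p ℚ.+ ℕ→ℚ n ℚ.* ε ℚ.≤ q)
∃-ℕ-multiple-below n {p} {q} p<q = ε , ℚ.positive⁻¹ ε {{ε-pos}} , (begin
  p ℚ.+ ℕ→ℚ n ℚ.* ε          ≤⟨ ℚ.+-monoʳ-≤ p (ℚ.*-monoʳ-≤-nonNeg ε {{ℚ.pos⇒nonNeg ε {{ε-pos}}}}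
                                   (ℕ→ℚ-mono-≤ (ℕ.n≤1+n n))) ⟩
  p ℚ.+ N ℚ.* ε              ≡⟨ cong (p ℚ.+_) (trans (sym (ℚ.*-assoc N (ℚ.1/ N) δ))
                                   (trans (cong (ℚ._* δ) (ℚ.*-inverseʳ N)) (ℚ.*-identityˡ δ))) ⟩
  p ℚ.+ δ                    ≡⟨ solve 2 (λ p q → p :+ (q :- p) := q) refl p q ⟩
  q                          ∎)
  where
  open ℚ.≤-Reasoning
  open +-*-Solver
  N = ℕ→ℚ (suc n)
  δ = q ℚ.- p
  instance
    N-pos : Positive N
    N-pos = ℕ→ℚ-suc-pos n
    N-nonZero : ℚ.NonZero N
    N-nonZero = ℚ.pos⇒nonZero N
    δ-pos : Positive δ
    δ-pos = ℚ.positive (subst (ℚ._< δ) (ℚ.+-inverseʳ p) (ℚ.+-monoˡ-< (ℚ.- p) p<q))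
  ε = ℚ.1/ N ℚ.* δ
  ε-pos : Positive ε
  ε-pos = ℚ.pos*pos⇒pos (ℚ.1/ N) {{ℚ.1/pos⇒pos N}} δ

<⇒∃-negative-slack : ∀ {p q} → p ℚ.< q → ∃[ s ] (s ℚ.< 0ℚ × p ℚ.< q ℚ.+ s)
<⇒∃-negative-slack {p} {q} p<q with ℚ.<-dense (subst (p ℚ.- q ℚ.<_) (ℚ.+-inverseʳ q) (ℚ.+-monoˡ-< (ℚ.- q) p<q))
... | s , p-q<s , s<0 = s , s<0 , subst (ℚ._< q ℚ.+ s) (solve 2 (λ p q → q :+ (p :- q) := p) refl p q)
                                        (ℚ.+-monoʳ-< q p-q<s)
  where open +-*-Solver

module RieszSpaceProperties {c ℓ₁ ℓ₂ : Level} (R : RieszSpace c ℓ₁ ℓ₂) where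
  open RieszSpace R

  lattice : Lattice c ℓ₁ ℓ₂
  lattice = record { isLattice = isLattice }

  open Lattice lattice public
    using (poset; x≤x∨y; y≤x∨y; ∨-least; x∧y≤x; x∧y≤y; ∧-greatest)
    renaming (refl to ≤-refl; trans to ≤-trans; antisym to ≤-antisym; reflexive to ≤-reflexive)
  open JoinProperties (Lattice.joinSemilattice lattice) public using (∨-monotonic; ∨-cong)
  open MeetProperties (Lattice.meetSemilattice lattice) public using (∧-monotonic; ∧-comm)
  open GroupProperties +ᴹ-group public using (//-rightDividesˡ; //-rightDividesʳ; inverseʳ-unique)
  open ≤-Reasoning poset

  +-monoʳ-≤ : ∀ z {x y} → x ≤ᴿ y → z +ᴹ x ≤ᴿ z +ᴹ y
  +-monoʳ-≤ z {x} {y} x≤y = begin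
    z +ᴹ x  ≈⟨ +ᴹ-comm z x ⟩
    x +ᴹ z  ≤⟨ +-mono z x≤y ⟩
    y +ᴹ z  ≈⟨ +ᴹ-comm y z ⟩
    z +ᴹ y  ∎

  +-mono-≤ : ∀ {x y u v} → x ≤ᴿ y → u ≤ᴿ v → x +ᴹ u ≤ᴿ y +ᴹ v
  +-mono-≤ {y = y} {u} x≤y u≤v = ≤-trans (+-mono u x≤y) (+-monoʳ-≤ y u≤v)

  x+z≤y⇒x≤y-z : ∀ {x y z} → x +ᴹ z ≤ᴿ y → x ≤ᴿ y -ᴹ z
  x+z≤y⇒x≤y-z {x} {y} {z} x+z≤y = begin
    x             ≈⟨ //-rightDividesʳ z x ⟨
    (x +ᴹ z) -ᴹ z ≤⟨ +-mono (-ᴹ z) x+z≤y ⟩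
    y -ᴹ z        ∎

  x≤y-z⇒x+z≤y : ∀ {x y z} → x ≤ᴿ y -ᴹ z → x +ᴹ z ≤ᴿ y
  x≤y-z⇒x+z≤y {x} {y} {z} x≤y-z = begin
    x +ᴹ z        ≤⟨ +-mono z x≤y-z ⟩
    y -ᴹ z +ᴹ z   ≈⟨ //-rightDividesˡ z y ⟩
    y             ∎

  x≤y+z⇒x-z≤y : ∀ {x y z} → x ≤ᴿ y +ᴹ z → x -ᴹ z ≤ᴿ y
  x≤y+z⇒x-z≤y {x} {y} {z} x≤y+z = begin
    x -ᴹ z        ≤⟨ +-mono (-ᴹ z) x≤y+z ⟩
    (y +ᴹ z) -ᴹ z ≈⟨ //-rightDividesʳ z y ⟩
    y             ∎

  x-z≤y⇒x≤y+z : ∀ {x y z} → x -ᴹ z ≤ᴿ y → x ≤ᴿ y +ᴹ z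
  x-z≤y⇒x≤y+z {x} {y} {z} x-z≤y = begin
    x             ≈⟨ //-rightDividesˡ z x ⟨
    x -ᴹ z +ᴹ z   ≤⟨ +-mono z x-z≤y ⟩
    y +ᴹ z        ∎

  +-cancelʳ-≤ : ∀ {x y} z → x +ᴹ z ≤ᴿ y +ᴹ z → x ≤ᴿ y
  +-cancelʳ-≤ {x} {y} z x+z≤y+z = ≤-trans (x+z≤y⇒x≤y-z x+z≤y+z) (≤-reflexive (//-rightDividesʳ z y))

  x≤y⇒0≤y-x : ∀ {x y} → x ≤ᴿ y → 0ᴹ ≤ᴿ y -ᴹ x
  x≤y⇒0≤y-x {x} {y} x≤y = x+z≤y⇒x≤y-z (≤-trans (≤-reflexive (+ᴹ-identityˡ x)) x≤y)

  ∨-+-∧ : ∀ x y → (x ∨ y) +ᴹ (x ∧ y) ≈ᴹ x +ᴹ y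
  ∨-+-∧ x y = ≤-antisym ≤-dir ≥-dir
    where
    ≤-dir : (x ∨ y) +ᴹ (x ∧ y) ≤ᴿ x +ᴹ y
    ≤-dir = x≤y-z⇒x+z≤y (∨-least
      (x+z≤y⇒x≤y-z (+-monoʳ-≤ x (x∧y≤y x y)))
      (x+z≤y⇒x≤y-z (≤-trans (+-monoʳ-≤ y (x∧y≤x x y)) (≤-reflexive (+ᴹ-comm y x)))))
    ≥-dir : x +ᴹ y ≤ᴿ (x ∨ y) +ᴹ (x ∧ y)
    ≥-dir = ≤-trans (x-z≤y⇒x≤y+z (∧-greatest
      (x≤y+z⇒x-z≤y (+-monoʳ-≤ x (y≤x∨y x y)))
      (x≤y+z⇒x-z≤y (≤-trans (≤-reflexive (+ᴹ-comm x y)) (+-monoʳ-≤ y (x≤x∨y x y))))))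
      (≤-reflexive (+ᴹ-comm (x ∧ y) (x ∨ y)))

  -- Adding S = x ∨ (y ∨ z) to both sides and using ∨-+-∧ reduces the claim to
  -- y + x ≤ T + S and z + x ≤ T + S, each of which is again an instance of ∨-+-∧.
  ∧-distribˡ-∨-≤ : ∀ x y z → x ∧ (y ∨ z) ≤ᴿ (x ∧ y) ∨ (x ∧ z)
  ∧-distribˡ-∨-≤ x y z = +-cancelʳ-≤ S (begin
    x ∧ (y ∨ z) +ᴹ S     ≈⟨ +ᴹ-comm (x ∧ (y ∨ z)) S ⟩
    S +ᴹ x ∧ (y ∨ z)     ≈⟨ ∨-+-∧ x (y ∨ z) ⟩
    x +ᴹ (y ∨ z)         ≈⟨ +ᴹ-comm x (y ∨ z) ⟩
    (y ∨ z) +ᴹ x         ≤⟨ x≤y-z⇒x+z≤y (∨-least (x+z≤y⇒x≤y-z (bound y (x≤x∨y y z) (x≤x∨y _ _)))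
                                               (x+z≤y⇒x≤y-z (bound z (y≤x∨y y z) (y≤x∨y _ _)))) ⟩
    T +ᴹ S               ∎)
    where
    S = x ∨ (y ∨ z)
    T = (x ∧ y) ∨ (x ∧ z)
    bound : ∀ w → w ≤ᴿ y ∨ z → x ∧ w ≤ᴿ T → w +ᴹ x ≤ᴿ T +ᴹ S
    bound w w≤y∨z x∧w≤T = begin
      w +ᴹ x              ≈⟨ +ᴹ-comm w x ⟩
      x +ᴹ w              ≈⟨ ∨-+-∧ x w ⟨
      (x ∨ w) +ᴹ (x ∧ w)  ≈⟨ +ᴹ-comm (x ∨ w) (x ∧ w) ⟩
      (x ∧ w) +ᴹ (x ∨ w)  ≤⟨ +-mono-≤ x∧w≤T (∨-monotonic ≤-refl w≤y∨z) ⟩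
      T +ᴹ S              ∎

  ∧-distribʳ-∨-≤ : ∀ x y z → (y ∨ z) ∧ x ≤ᴿ (y ∧ x) ∨ (z ∧ x)
  ∧-distribʳ-∨-≤ x y z = begin
    (y ∨ z) ∧ x            ≈⟨ ∧-comm (y ∨ z) x ⟩
    x ∧ (y ∨ z)            ≤⟨ ∧-distribˡ-∨-≤ x y z ⟩
    (x ∧ y) ∨ (x ∧ z)      ≈⟨ ∨-cong (∧-comm x y) (∧-comm x z) ⟩
    (y ∧ x) ∨ (z ∧ x)      ∎

  module _ {f g : Carrierᴹ → Carrierᴹ}
           (f-mono : ∀ {x y} → x ≤ᴿ y → f x ≤ᴿ f y) (g-mono : ∀ {x y} → x ≤ᴿ y → g x ≤ᴿ g y)
           (g∘f≈id : ∀ x → g (f x) ≈ᴹ x) (f∘g≈id : ∀ x → f (g x) ≈ᴹ x) where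

    order-iso-∨-≤ : ∀ x y → f (x ∨ y) ≤ᴿ f x ∨ f y
    order-iso-∨-≤ x y = begin
      f (x ∨ y)           ≤⟨ f-mono (∨-least (below-g x (x≤x∨y (f x) (f y))) (below-g y (y≤x∨y (f x) (f y)))) ⟩
      f (g (f x ∨ f y))   ≈⟨ f∘g≈id (f x ∨ f y) ⟩
      f x ∨ f y           ∎
      where
      below-g : ∀ z → f z ≤ᴿ f x ∨ f y → z ≤ᴿ g (f x ∨ f y)
      below-g z fz≤ = ≤-trans (≤-reflexive (≈ᴹ-sym (g∘f≈id z))) (g-mono fz≤)

    order-iso-∧-≥ : ∀ x y → f x ∧ f y ≤ᴿ f (x ∧ y)
    order-iso-∧-≥ x y = begin
      f x ∧ f y           ≈⟨ f∘g≈id (f x ∧ f y) ⟨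
      f (g (f x ∧ f y))   ≤⟨ f-mono (∧-greatest (above-g x (x∧y≤x (f x) (f y))) (above-g y (x∧y≤y (f x) (f y)))) ⟩
      f (x ∧ y)           ∎
      where
      above-g : ∀ z → f x ∧ f y ≤ᴿ f z → g (f x ∧ f y) ≤ᴿ z
      above-g z ≤fz = ≤-trans (g-mono ≤fz) (≤-reflexive (g∘f≈id z))

  *ₗ-neg : ∀ q x → q *ₗ (-ᴹ x) ≈ᴹ -ᴹ (q *ₗ x)
  *ₗ-neg q x = inverseʳ-unique (q *ₗ x) (q *ₗ (-ᴹ x)) (begin-equality
    q *ₗ x +ᴹ q *ₗ (-ᴹ x)  ≈⟨ *ₗ-distribˡ q x (-ᴹ x) ⟨
    q *ₗ (x -ᴹ x)          ≈⟨ *ₗ-congˡ (-ᴹ‿inverseʳ x) ⟩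
    q *ₗ 0ᴹ                ≈⟨ *ₗ-zeroʳ q ⟩
    0ᴹ                     ∎)

  *ₗ-monoʳ-≤ : ∀ {q} → 0ℚ ℚ.≤ q → ∀ {x y} → x ≤ᴿ y → q *ₗ x ≤ᴿ q *ₗ y
  *ₗ-monoʳ-≤ {q} 0≤q {x} {y} x≤y = begin
    q *ₗ x          ≈⟨ +ᴹ-identityˡ (q *ₗ x) ⟨
    0ᴹ +ᴹ q *ₗ x    ≤⟨ x≤y-z⇒x+z≤y (≤-trans (*-nonneg 0≤q (x≤y⇒0≤y-x x≤y)) (≤-reflexive q[y-x]≈qy-qx)) ⟩
    q *ₗ y          ∎
    where
    q[y-x]≈qy-qx : q *ₗ (y -ᴹ x) ≈ᴹ (q *ₗ y) -ᴹ (q *ₗ x)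
    q[y-x]≈qy-qx = ≈ᴹ-trans (*ₗ-distribˡ q y (-ᴹ x)) (+ᴹ-congˡ (*ₗ-neg q x))

  *ₗ-inverse : ∀ {p q} → p ℚ.* q ≡ 1ℚ → ∀ x → p *ₗ (q *ₗ x) ≈ᴹ x
  *ₗ-inverse {p} {q} pq≡1 x = begin-equality
    p *ₗ (q *ₗ x)   ≈⟨ *ₗ-assoc p q x ⟨
    (p ℚ.* q) *ₗ x  ≈⟨ *ₗ-congʳ pq≡1 ⟩
    1ℚ *ₗ x         ≈⟨ *ₗ-identityˡ x ⟩
    x               ∎

  module _ (q : ℚ) .{{_ : Positive q}} where
    private
      instance
        q≢0 : ℚ.NonZero q
        q≢0 = ℚ.pos⇒nonZero q
      0≤q : 0ℚ ℚ.≤ q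
      0≤q = ℚ.<⇒≤ (ℚ.positive⁻¹ q)
      0≤1/q : 0ℚ ℚ.≤ ℚ.1/ q
      0≤1/q = ℚ.<⇒≤ (ℚ.positive⁻¹ (ℚ.1/ q) {{ℚ.1/pos⇒pos q}})

    *ₗ-∨-≤ : ∀ x y → q *ₗ (x ∨ y) ≤ᴿ (q *ₗ x) ∨ (q *ₗ y)
    *ₗ-∨-≤ = order-iso-∨-≤ (*ₗ-monoʳ-≤ 0≤q) (*ₗ-monoʳ-≤ 0≤1/q)
               (*ₗ-inverse (ℚ.*-inverseˡ q)) (*ₗ-inverse (ℚ.*-inverseʳ q))

    *ₗ-∧-≥ : ∀ x y → (q *ₗ x) ∧ (q *ₗ y) ≤ᴿ q *ₗ (x ∧ y)
    *ₗ-∧-≥ = order-iso-∧-≥ (*ₗ-monoʳ-≤ 0≤q) (*ₗ-monoʳ-≤ 0≤1/q)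
               (*ₗ-inverse (ℚ.*-inverseˡ q)) (*ₗ-inverse (ℚ.*-inverseʳ q))

    *ₗ-cancelˡ-≤ : ∀ {x y} → q *ₗ x ≤ᴿ q *ₗ y → x ≤ᴿ y
    *ₗ-cancelˡ-≤ {x} {y} qx≤qy = begin
      x                      ≈⟨ *ₗ-inverse (ℚ.*-inverseˡ q) x ⟨
      ℚ.1/ q *ₗ (q *ₗ x)     ≤⟨ *ₗ-monoʳ-≤ 0≤1/q qx≤qy ⟩
      ℚ.1/ q *ₗ (q *ₗ y)     ≈⟨ *ₗ-inverse (ℚ.*-inverseˡ q) y ⟩
      y                      ∎

  infixr 7 _·_
  _·_ : ℕ → Carrierᴹ → Carrierᴹ
  k · x = ℕ→ℚ k *ₗ x

  ·-monoʳ-≤ : ∀ k {x y} → x ≤ᴿ y → k · x ≤ᴿ k · y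
  ·-monoʳ-≤ k = *ₗ-monoʳ-≤ (0≤ℕ→ℚ k)

  ·-nonneg : ∀ k {x} → 0ᴹ ≤ᴿ x → 0ᴹ ≤ᴿ k · x
  ·-nonneg k = *-nonneg (0≤ℕ→ℚ k)

  ·-distribʳ-+ : ∀ m n x → (m ℕ.+ n) · x ≈ᴹ m · x +ᴹ n · x
  ·-distribʳ-+ m n x = ≈ᴹ-trans (*ₗ-congʳ (ℕ→ℚ-homo-+ m n)) (*ₗ-distribʳ x (ℕ→ℚ m) (ℕ→ℚ n))

  ·-monoˡ-≤ : ∀ {m n x} → 0ᴹ ≤ᴿ x → m ℕ.≤ n → m · x ≤ᴿ n · x
  ·-monoˡ-≤ {m} {n} {x} 0≤x m≤n = subst (λ k → m · x ≤ᴿ k · x) (ℕ.m+[n∸m]≡n m≤n) (begin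
    m · x                      ≈⟨ +ᴹ-identityʳ (m · x) ⟨
    m · x +ᴹ 0ᴹ                ≤⟨ +-monoʳ-≤ (m · x) (·-nonneg (n ℕ.∸ m) 0≤x) ⟩
    m · x +ᴹ (n ℕ.∸ m) · x     ≈⟨ ·-distribʳ-+ m (n ℕ.∸ m) x ⟨
    (m ℕ.+ (n ℕ.∸ m)) · x      ∎)

  ·-∨-≤ : ∀ k x y → k · (x ∨ y) ≤ᴿ (k · x) ∨ (k · y)
  ·-∨-≤ zero    x y = ≤-trans (≤-reflexive (≈ᴹ-trans (*ₗ-zeroˡ (x ∨ y)) (≈ᴹ-sym (*ₗ-zeroˡ x))))
                               (x≤x∨y (0 · x) (0 · y))
  ·-∨-≤ (suc k) x y = *ₗ-∨-≤ (ℕ→ℚ (suc k)) {{ℕ→ℚ-suc-pos k}} x y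

  ·-∧-≥ : ∀ k x y → (k · x) ∧ (k · y) ≤ᴿ k · (x ∧ y)
  ·-∧-≥ zero    x y = ≤-trans (x∧y≤x (0 · x) (0 · y))
                               (≤-reflexive (≈ᴹ-trans (*ₗ-zeroˡ x) (≈ᴹ-sym (*ₗ-zeroˡ (x ∧ y)))))
  ·-∧-≥ (suc k) x y = *ₗ-∧-≥ (ℕ→ℚ (suc k)) {{ℕ→ℚ-suc-pos k}} x y

  ·-suc : ∀ n x → suc n · x ≈ᴹ x +ᴹ n · x
  ·-suc n x = ≈ᴹ-trans (·-distribʳ-+ 1 n x) (+ᴹ-congʳ (*ₗ-identityˡ x))

  ·-cancelˡ-≤ : ∀ n {x y} → suc n · x ≤ᴿ suc n · y → x ≤ᴿ y
  ·-cancelˡ-≤ n = *ₗ-cancelˡ-≤ (ℕ→ℚ (suc n)) {{ℕ→ℚ-suc-pos n}}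

  0≤1ᴿ : 0ᴹ ≤ᴿ 1ᴿ
  0≤1ᴿ with strongUnit 1ᴿ
  ... | n , -n·1≤1 , _ = ·-cancelˡ-≤ n (begin
    suc n · 0ᴹ        ≈⟨ *ₗ-zeroʳ (ℕ→ℚ (suc n)) ⟩
    0ᴹ                ≤⟨ x-z≤y⇒x≤y+z (≤-trans (≤-reflexive (+ᴹ-identityˡ _)) -n·1≤1) ⟩
    1ᴿ +ᴹ n · 1ᴿ      ≈⟨ ·-suc n 1ᴿ ⟨
    suc n · 1ᴿ        ∎)

  x∧-x≤0 : ∀ x → x ∧ (-ᴹ x) ≤ᴿ 0ᴹ
  x∧-x≤0 x = ·-cancelˡ-≤ 1 (begin
    2 · w             ≈⟨ ·-suc 1 w ⟩
    w +ᴹ 1 · w        ≈⟨ +ᴹ-congˡ (*ₗ-identityˡ w) ⟩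
    w +ᴹ w            ≤⟨ +-mono-≤ (x∧y≤x x (-ᴹ x)) (x∧y≤y x (-ᴹ x)) ⟩
    x -ᴹ x            ≈⟨ -ᴹ‿inverseʳ x ⟩
    0ᴹ                ≈⟨ *ₗ-zeroʳ (ℕ→ℚ 2) ⟨
    2 · 0ᴹ            ∎)
    where w = x ∧ (-ᴹ x)

  0≤x⁺ : ∀ x → 0ᴹ ≤ᴿ x ⁺
  0≤x⁺ x = y≤x∨y x 0ᴹ

  ⁺-mono-≤ : ∀ {x y} → x ≤ᴿ y → x ⁺ ≤ᴿ y ⁺
  ⁺-mono-≤ x≤y = ∨-monotonic x≤y ≤-refl

  x≤0⇒x⁺≤0 : ∀ {x} → x ≤ᴿ 0ᴹ → x ⁺ ≤ᴿ 0ᴹ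
  x≤0⇒x⁺≤0 x≤0 = ∨-least x≤0 ≤-refl

  ⁺-∨-≤ : ∀ x y → (x ∨ y) ⁺ ≤ᴿ (x ⁺) ∨ (y ⁺)
  ⁺-∨-≤ x y = ∨-least (∨-monotonic (x≤x∨y x 0ᴹ) (x≤x∨y y 0ᴹ)) (≤-trans (0≤x⁺ x) (x≤x∨y (x ⁺) (y ⁺)))

  ⁺-∧-≥ : ∀ x y → (x ⁺) ∧ (y ⁺) ≤ᴿ (x ∧ y) ⁺
  ⁺-∧-≥ x y = begin
    (x ⁺) ∧ (y ∨ 0ᴹ)                           ≤⟨ ∧-distribˡ-∨-≤ (x ⁺) y 0ᴹ ⟩
    ((x ∨ 0ᴹ) ∧ y) ∨ ((x ⁺) ∧ 0ᴹ)              ≤⟨ ∨-monotonic (∧-distribʳ-∨-≤ y x 0ᴹ) (x∧y≤y (x ⁺) 0ᴹ) ⟩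
    ((x ∧ y) ∨ (0ᴹ ∧ y)) ∨ 0ᴹ                  ≤⟨ ∨-least (∨-monotonic ≤-refl (x∧y≤x 0ᴹ y)) (y≤x∨y (x ∧ y) 0ᴹ) ⟩
    (x ∧ y) ⁺                                  ∎

  ⁺-+-≤ : ∀ x y → (x +ᴹ y) ⁺ ≤ᴿ (x ∨ y) ⁺ +ᴹ (x ∨ y) ⁺
  ⁺-+-≤ x y = ∨-least (+-mono-≤ (≤-trans (x≤x∨y x y) (x≤x∨y _ 0ᴹ)) (≤-trans (y≤x∨y x y) (x≤x∨y _ 0ᴹ)))
                      (≤-trans (≤-reflexive (≈ᴹ-sym (+ᴹ-identityˡ 0ᴹ))) (+-mono-≤ (0≤x⁺ (x ∨ y)) (0≤x⁺ (x ∨ y))))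

  trunc : ℕ → Carrierᴹ → Carrierᴹ
  trunc n x = (n · (x ⁺)) ∧ 1ᴿ

  trunc≤1 : ∀ n x → trunc n x ≤ᴿ 1ᴿ
  trunc≤1 n x = x∧y≤y (n · (x ⁺)) 1ᴿ

  0≤trunc : ∀ n x → 0ᴹ ≤ᴿ trunc n x
  0≤trunc n x = ∧-greatest (·-nonneg n (0≤x⁺ x)) 0≤1ᴿ

  x≤0⇒trunc≤0 : ∀ n {x} → x ≤ᴿ 0ᴹ → trunc n x ≤ᴿ 0ᴹ
  x≤0⇒trunc≤0 n {x} x≤0 = begin
    trunc n x         ≤⟨ x∧y≤x (n · (x ⁺)) 1ᴿ ⟩
    n · (x ⁺)         ≤⟨ ·-monoʳ-≤ n (x≤0⇒x⁺≤0 x≤0) ⟩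
    n · 0ᴹ            ≈⟨ *ₗ-zeroʳ (ℕ→ℚ n) ⟩
    0ᴹ                ∎

  1≤trunc-1-1 : 1ᴿ ≤ᴿ trunc 1 1ᴿ
  1≤trunc-1-1 = ∧-greatest (≤-trans (x≤x∨y 1ᴿ 0ᴹ) (≤-reflexive (≈ᴹ-sym (*ₗ-identityˡ (1ᴿ ⁺))))) ≤-refl

  trunc-monoʳ-≤ : ∀ n {x y} → x ≤ᴿ y → trunc n x ≤ᴿ trunc n y
  trunc-monoʳ-≤ n x≤y = ∧-monotonic (·-monoʳ-≤ n (⁺-mono-≤ x≤y)) ≤-refl

  trunc-monoˡ-≤ : ∀ {m n} x → m ℕ.≤ n → trunc m x ≤ᴿ trunc n x
  trunc-monoˡ-≤ x m≤n = ∧-monotonic (·-monoˡ-≤ (0≤x⁺ x) m≤n) ≤-refl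

  trunc-∨-≤ : ∀ n x y → trunc n (x ∨ y) ≤ᴿ trunc n x ∨ trunc n y
  trunc-∨-≤ n x y = begin
    (n · ((x ∨ y) ⁺)) ∧ 1ᴿ              ≤⟨ ∧-monotonic (·-monoʳ-≤ n (⁺-∨-≤ x y)) ≤-refl ⟩
    (n · ((x ⁺) ∨ (y ⁺))) ∧ 1ᴿ          ≤⟨ ∧-monotonic (·-∨-≤ n (x ⁺) (y ⁺)) ≤-refl ⟩
    ((n · (x ⁺)) ∨ (n · (y ⁺))) ∧ 1ᴿ    ≤⟨ ∧-distribʳ-∨-≤ 1ᴿ (n · (x ⁺)) (n · (y ⁺)) ⟩
    trunc n x ∨ trunc n y               ∎

  trunc-∧-≥ : ∀ n x y → trunc n x ∧ trunc n y ≤ᴿ trunc n (x ∧ y)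
  trunc-∧-≥ n x y = ∧-greatest (begin
    trunc n x ∧ trunc n y               ≤⟨ ∧-monotonic (x∧y≤x _ 1ᴿ) (x∧y≤x _ 1ᴿ) ⟩
    (n · (x ⁺)) ∧ (n · (y ⁺))           ≤⟨ ·-∧-≥ n (x ⁺) (y ⁺) ⟩
    n · ((x ⁺) ∧ (y ⁺))                 ≤⟨ ·-monoʳ-≤ n (⁺-∧-≥ x y) ⟩
    n · ((x ∧ y) ⁺)                     ∎)
    (≤-trans (x∧y≤y (trunc n x) (trunc n y)) (trunc≤1 n y))

  [x+k]∧u≤x∧u+k : ∀ x u {k} → 0ᴹ ≤ᴿ k → (x +ᴹ k) ∧ u ≤ᴿ (x ∧ u) +ᴹ k
  [x+k]∧u≤x∧u+k x u {k} 0≤k = x-z≤y⇒x≤y+z (∧-greatest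
    (x≤y+z⇒x-z≤y (x∧y≤x (x +ᴹ k) u))
    (x≤y+z⇒x-z≤y (≤-trans (x∧y≤y (x +ᴹ k) u)
                          (≤-trans (≤-reflexive (≈ᴹ-sym (+ᴹ-identityʳ u))) (+-monoʳ-≤ u 0≤k)))))

  trunc-≤-shift : ∀ n x {ε} → 0ℚ ℚ.≤ ε → trunc n x ≤ᴿ trunc n (x -ᴹ (ε *ₗ 1ᴿ)) +ᴹ (ℕ→ℚ n ℚ.* ε) *ₗ 1ᴿ
  trunc-≤-shift n x {ε} 0≤ε = begin
    (n · (x ⁺)) ∧ 1ᴿ                     ≤⟨ ∧-monotonic (·-monoʳ-≤ n x⁺≤[x-e]⁺+e) ≤-refl ⟩
    (n · ((x -ᴹ e) ⁺ +ᴹ e)) ∧ 1ᴿ         ≤⟨ ∧-monotonic (≤-reflexive n·[y+e]≈n·y+nε) ≤-refl ⟩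
    (n · ((x -ᴹ e) ⁺) +ᴹ nε) ∧ 1ᴿ         ≤⟨ [x+k]∧u≤x∧u+k (n · ((x -ᴹ e) ⁺)) 1ᴿ 0≤nε ⟩
    trunc n (x -ᴹ e) +ᴹ nε                ∎
    where
    e = ε *ₗ 1ᴿ
    nε = (ℕ→ℚ n ℚ.* ε) *ₗ 1ᴿ
    0≤e : 0ᴹ ≤ᴿ e
    0≤e = *-nonneg 0≤ε 0≤1ᴿ
    0≤nε : 0ᴹ ≤ᴿ nε
    0≤nε = *-nonneg (0≤ℕ→ℚ* n 0≤ε) 0≤1ᴿ
    x⁺≤[x-e]⁺+e : x ⁺ ≤ᴿ (x -ᴹ e) ⁺ +ᴹ e
    x⁺≤[x-e]⁺+e = ∨-least (x-z≤y⇒x≤y+z (x≤x∨y (x -ᴹ e) 0ᴹ))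
                          (≤-trans (≤-reflexive (≈ᴹ-sym (+ᴹ-identityˡ 0ᴹ))) (+-mono-≤ (0≤x⁺ (x -ᴹ e)) 0≤e))
    n·[y+e]≈n·y+nε : n · ((x -ᴹ e) ⁺ +ᴹ e) ≈ᴹ n · ((x -ᴹ e) ⁺) +ᴹ nε
    n·[y+e]≈n·y+nε = ≈ᴹ-trans (*ₗ-distribˡ (ℕ→ℚ n) ((x -ᴹ e) ⁺) e) (+ᴹ-congˡ (≈ᴹ-sym (*ₗ-assoc (ℕ→ℚ n) ε 1ᴿ)))

  trunc-modular-≤ : ∀ n x y → trunc n x +ᴹ trunc n y ≤ᴿ trunc n (x ∨ y) +ᴹ trunc n (x ∧ y)
  trunc-modular-≤ n x y = begin
    trunc n x +ᴹ trunc n y                                    ≈⟨ ∨-+-∧ (trunc n x) (trunc n y) ⟨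
    (trunc n x ∨ trunc n y) +ᴹ (trunc n x ∧ trunc n y)        ≤⟨ +-mono-≤
      (∨-least (trunc-monoʳ-≤ n (x≤x∨y x y)) (trunc-monoʳ-≤ n (y≤x∨y x y))) (trunc-∧-≥ n x y) ⟩
    trunc n (x ∨ y) +ᴹ trunc n (x ∧ y)                        ∎

  trunc-modular-≥ : ∀ n x y → trunc n (x ∨ y) +ᴹ trunc n (x ∧ y) ≤ᴿ trunc n x +ᴹ trunc n y
  trunc-modular-≥ n x y = begin
    trunc n (x ∨ y) +ᴹ trunc n (x ∧ y)                        ≤⟨ +-mono-≤ (trunc-∨-≤ n x y)
      (∧-greatest (trunc-monoʳ-≤ n (x∧y≤x x y)) (trunc-monoʳ-≤ n (x∧y≤y x y))) ⟩
    (trunc n x ∨ trunc n y) +ᴹ (trunc n x ∧ trunc n y)        ≈⟨ ∨-+-∧ (trunc n x) (trunc n y) ⟩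
    trunc n x +ᴹ trunc n y                                    ∎

  infix 4 _≼_
  _≼_ : Carrierᴹ → Carrierᴹ → Set ℓ₂
  x ≼ y = ∀ n → ∃[ m ] (trunc n x ≤ᴿ m · (y ⁺))

  ≼⇒trunc-≤ : ∀ {x y} → x ≼ y → ∀ n → ∃[ m ] (trunc n x ≤ᴿ trunc m y)
  ≼⇒trunc-≤ {x} x≼y n with x≼y n
  ... | m , le = m , ∧-greatest le (trunc≤1 n x)

  ≤⇒≼ : ∀ {x y} → x ≤ᴿ y → x ≼ y
  ≤⇒≼ {x} x≤y n = n , ≤-trans (x∧y≤x (n · (x ⁺)) 1ᴿ) (·-monoʳ-≤ n (⁺-mono-≤ x≤y))

  ≼-refl : ∀ {x} → x ≼ x
  ≼-refl = ≤⇒≼ ≤-refl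

  ≼-trans : ∀ {x y z} → x ≼ y → y ≼ z → x ≼ z
  ≼-trans x≼y y≼z n with ≼⇒trunc-≤ x≼y n
  ... | m , le with y≼z m
  ... | k , le′ = k , ≤-trans le le′

  x≤0⇒x≼y : ∀ {x} y → x ≤ᴿ 0ᴹ → x ≼ y
  x≤0⇒x≼y {x} y x≤0 n = 0 , ≤-trans (x≤0⇒trunc≤0 n x≤0) (≤-reflexive (≈ᴹ-sym (*ₗ-zeroˡ (y ⁺))))

  x≼1 : ∀ x → x ≼ 1ᴿ
  x≼1 x n = 1 , (begin
    trunc n x         ≤⟨ trunc≤1 n x ⟩
    1ᴿ                ≤⟨ x≤x∨y 1ᴿ 0ᴹ ⟩
    1ᴿ ⁺              ≈⟨ *ₗ-identityˡ (1ᴿ ⁺) ⟨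
    1 · (1ᴿ ⁺)        ∎)

  ≼-∨ : ∀ {x y z} → x ≼ z → y ≼ z → x ∨ y ≼ z
  ≼-∨ {x} {y} {z} x≼z y≼z n with x≼z n | y≼z n
  ... | m₁ , le₁ | m₂ , le₂ = m₁ ℕ.⊔ m₂ , (begin
    trunc n (x ∨ y)              ≤⟨ trunc-∨-≤ n x y ⟩
    trunc n x ∨ trunc n y        ≤⟨ ∨-least (≤-trans le₁ (·-monoˡ-≤ (0≤x⁺ z) (ℕ.m≤m⊔n m₁ m₂)))
                                            (≤-trans le₂ (·-monoˡ-≤ (0≤x⁺ z) (ℕ.m≤n⊔m m₁ m₂))) ⟩
    (m₁ ℕ.⊔ m₂) · (z ⁺)          ∎)

  ≼-∧ : ∀ {x y z} → z ≼ x → z ≼ y → z ≼ x ∧ y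
  ≼-∧ {x} {y} {z} z≼x z≼y n with z≼x n | z≼y n
  ... | m₁ , le₁ | m₂ , le₂ = m , (begin
    trunc n z                    ≤⟨ ∧-greatest (≤-trans le₁ (·-monoˡ-≤ (0≤x⁺ x) (ℕ.m≤m⊔n m₁ m₂)))
                                               (≤-trans le₂ (·-monoˡ-≤ (0≤x⁺ y) (ℕ.m≤n⊔m m₁ m₂))) ⟩
    (m · (x ⁺)) ∧ (m · (y ⁺))    ≤⟨ ·-∧-≥ m (x ⁺) (y ⁺) ⟩
    m · ((x ⁺) ∧ (y ⁺))          ≤⟨ ·-monoʳ-≤ m (⁺-∧-≥ x y) ⟩
    m · ((x ∧ y) ⁺)              ∎)
    where m = m₁ ℕ.⊔ m₂

  x+y≼x∨y : ∀ x y → x +ᴹ y ≼ x ∨ y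
  x+y≼x∨y x y n = n ℕ.+ n , (begin
    trunc n (x +ᴹ y)             ≤⟨ x∧y≤x (n · ((x +ᴹ y) ⁺)) 1ᴿ ⟩
    n · ((x +ᴹ y) ⁺)             ≤⟨ ·-monoʳ-≤ n (⁺-+-≤ x y) ⟩
    n · (X +ᴹ X)                 ≈⟨ *ₗ-distribˡ (ℕ→ℚ n) X X ⟩
    n · X +ᴹ n · X               ≈⟨ ·-distribʳ-+ n n X ⟨
    (n ℕ.+ n) · X                ∎)
    where X = (x ∨ y) ⁺

  ⟦_⟧ : SpecTerm R → Carrierᴹ
  ⟦ D a ⟧   = a
  ⟦ ⊤ˢ ⟧    = 1ᴿ
  ⟦ ⊥ˢ ⟧    = 0ᴹ
  ⟦ s ⋁ t ⟧ = ⟦ s ⟧ ∨ ⟦ t ⟧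
  ⟦ s ⋀ t ⟧ = ⟦ s ⟧ ∧ ⟦ t ⟧

  ⟦⟧-mono : ∀ {s t} → _⊑_ R s t → ⟦ s ⟧ ≼ ⟦ t ⟧
  ⟦⟧-mono ⊑-refl        = ≼-refl
  ⟦⟧-mono (⊑-trans p q) = ≼-trans (⟦⟧-mono p) (⟦⟧-mono q)
  ⟦⟧-mono ⊥-min         = x≤0⇒x≼y _ ≤-refl
  ⟦⟧-mono ⊤-max         = x≼1 _
  ⟦⟧-mono ⋁-inl         = ≤⇒≼ (x≤x∨y _ _)
  ⟦⟧-mono ⋁-inr         = ≤⇒≼ (y≤x∨y _ _)
  ⟦⟧-mono (⋁-lub p q)   = ≼-∨ (⟦⟧-mono p) (⟦⟧-mono q)
  ⟦⟧-mono ⋀-prl         = ≤⇒≼ (x∧y≤x _ _)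
  ⟦⟧-mono ⋀-prr         = ≤⇒≼ (x∧y≤y _ _)
  ⟦⟧-mono (⋀-glb p q)   = ≼-∧ (⟦⟧-mono p) (⟦⟧-mono q)
  ⟦⟧-mono distrib       = ≤⇒≼ (∧-distribˡ-∨-≤ _ _ _)
  ⟦⟧-mono (D-cong a≈b)  = ≤⇒≼ (≤-reflexive a≈b)
  ⟦⟧-mono D-one         = ≼-refl
  ⟦⟧-mono D-neg         = x≤0⇒x≼y _ (x∧-x≤0 _)
  ⟦⟧-mono D-add         = x+y≼x∨y _ _
  ⟦⟧-mono (D-nonpos a≤0) = x≤0⇒x≼y _ a≤0
  ⟦⟧-mono D-join₁       = ≼-refl
  ⟦⟧-mono D-join₂       = ≼-refl

open Equivalence using (to; from)

L-downClosed-< : ∀ (x : ℝ) {p q} → p ℚ.< q → L x q → L x p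
L-downClosed-< x {p} {q} p<q xq = from (L-rounded x p) (q , p<q , xq)

L-downClosed : ∀ (x : ℝ) {p q} → p ℚ.≤ q → L x q → L x p
L-downClosed x {p} {q} p≤q xq with to (L-rounded x q) xq
... | r , q<r , xr = L-downClosed-< x (ℚ.≤-<-trans p≤q q<r) xr

module IntegralProperties {c ℓ₁ ℓ₂ : Level} {R : RieszSpace c ℓ₁ ℓ₂} (𝓘 : Integral R) where
  open RieszSpace R
  open RieszSpaceProperties R
  open Integral 𝓘

  LI : Carrierᴹ → Cut
  LI u = L (I u)

  LI-negative : ∀ {u} → 0ᴹ ≤ᴿ u → below 0ℚ ⊆ LI u
  LI-negative {u} 0≤u s s<0 with ℚ.<-dense s<0
  ... | t , s<t , t<0 with located (I u) s<t
  ... | inj₁ Ls = Ls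
  ... | inj₂ Ut = ⊥-elim (ℚ.<-irrefl refl (ℚ.<-≤-trans t<0 (positive u 0≤u t Ut)))

  LI-mono : ∀ {u v} → u ≤ᴿ v → LI u ⊆ LI v
  LI-mono {u} {v} u≤v p Lp =
    let r , p<r , Lr    = to (L-rounded (I u) p) Lp
        s , s<0 , p<r+s = <⇒∃-negative-slack p<r
    in to (I-cong u+[v-u]≈v p)
      (from (additive u (v -ᴹ u) p) (r , s , Lr , LI-negative (x≤y⇒0≤y-x u≤v) s s<0 , p<r+s))
    where
    u+[v-u]≈v : u +ᴹ (v -ᴹ u) ≈ᴹ v
    u+[v-u]≈v = ≈ᴹ-trans (+ᴹ-comm u (v -ᴹ u)) (//-rightDividesˡ u v)

  LI[q·1]<q : ∀ {q s} → 0ℚ ℚ.≤ q → LI (q *ₗ 1ᴿ) s → s ℚ.< q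
  LI[q·1]<q {q} {s} 0≤q Ls =
    let r , t , Lr , _ , s<qr⊓qt = to (homogeneous q 1ᴿ s) Ls
    in begin-strict
      s                      <⟨ s<qr⊓qt ⟩
      (q ℚ.* r) ℚ.⊓ (q ℚ.* t) ≤⟨ ℚ.p⊓q≤p (q ℚ.* r) (q ℚ.* t) ⟩
      q ℚ.* r                ≤⟨ ℚ.*-monoˡ-≤-nonNeg q {{ℚ.nonNegative 0≤q}} (ℚ.<⇒≤ (to (unital r) Lr)) ⟩
      q ℚ.* 1ℚ               ≡⟨ ℚ.*-identityʳ q ⟩
      q                      ∎
    where open ℚ.≤-Reasoning

  LI-0 : LI 0ᴹ ≐ below 0ℚ
  LI-0 p = mk⇔ (λ Lp → LI[q·1]<q ℚ.≤-refl (to (I-cong (≈ᴹ-sym (*ₗ-zeroˡ 1ᴿ)) p) Lp))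
               (LI-negative ≤-refl p)

  LI-+ᶜ-mono : ∀ {u v u′ v′} → u +ᴹ v ≤ᴿ u′ +ᴹ v′ → LI u +ᶜ LI v ⊆ LI u′ +ᶜ LI v′
  LI-+ᶜ-mono {u} {v} {u′} {v′} u+v≤u′+v′ p p∈LIu+LIv =
    to (additive u′ v′ p) (LI-mono u+v≤u′+v′ p (from (additive u v p) p∈LIu+LIv))

  μ : Carrierᴹ → Cut
  μ = μI R 𝓘

  μ-lowerReal : Carrierᴹ → LowerReal
  μ-lowerReal a = record
    { cut        = μ a
    ; inhabited  = let p , Lp = L-inhabited (I (trunc 0 a)) in p , 0 , Lp
    ; downClosed = λ { p≤q (n , Lq) → n , L-downClosed (I (trunc n a)) p≤q Lq }
    ; roundedUp  = λ { {p} (n , Lp) → let q , p<q , Lq = to (L-rounded (I (trunc n a)) p) Lp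
                                      in q , p<q , n , Lq }
    }

  μ-nonneg : ∀ a → below 0ℚ ⊆ μ a
  μ-nonneg a p p<0 = 0 , LI-negative (0≤trunc 0 a) p p<0

  μ-mono : ∀ {a b} → a ≼ b → μ a ⊆ μ b
  μ-mono a≼b p (n , Lp) = let m , le = ≼⇒trunc-≤ a≼b n in m , LI-mono le p Lp

  μ-0 : μ 0ᴹ ≐ below 0ℚ
  μ-0 p = mk⇔ (λ { (n , Lp) → to (LI-0 p) (LI-mono (x≤0⇒trunc≤0 n ≤-refl) p Lp) }) (μ-nonneg 0ᴹ p)

  μ-1 : μ 1ᴿ ≐ below 1ℚ
  μ-1 p = mk⇔ (λ { (n , Lp) → to (unital p) (LI-mono (trunc≤1 n 1ᴿ) p Lp) })
              (λ p<1 → 1 , LI-mono 1≤trunc-1-1 p (from (unital p) p<1))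

  μ-+ᶜ⇒LI-trunc-+ᶜ : ∀ a b {p} → (μ a +ᶜ μ b) p → ∃[ k ] (LI (trunc k a) +ᶜ LI (trunc k b)) p
  μ-+ᶜ⇒LI-trunc-+ᶜ a b (r , s , (n , Lr) , (m , Ls) , p<r+s) =
    n ℕ.⊔ m , r , s , LI-mono (trunc-monoˡ-≤ a (ℕ.m≤m⊔n n m)) r Lr
                    , LI-mono (trunc-monoˡ-≤ b (ℕ.m≤n⊔m n m)) s Ls , p<r+s

  LI-trunc-+ᶜ⇒μ-+ᶜ : ∀ k a b {p} → (LI (trunc k a) +ᶜ LI (trunc k b)) p → (μ a +ᶜ μ b) p
  LI-trunc-+ᶜ⇒μ-+ᶜ k a b (r , s , Lr , Ls , p<r+s) = r , s , (k , Lr) , (k , Ls) , p<r+s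

  μ-modular : ∀ a b → μ a +ᶜ μ b ≐ μ (a ∨ b) +ᶜ μ (a ∧ b)
  μ-modular a b p = mk⇔
    (λ h → let k , h′ = μ-+ᶜ⇒LI-trunc-+ᶜ a b h
           in LI-trunc-+ᶜ⇒μ-+ᶜ k (a ∨ b) (a ∧ b) (LI-+ᶜ-mono (trunc-modular-≤ k a b) p h′))
    (λ h → let k , h′ = μ-+ᶜ⇒LI-trunc-+ᶜ (a ∨ b) (a ∧ b) h
           in LI-trunc-+ᶜ⇒μ-+ᶜ k a b (LI-+ᶜ-mono (trunc-modular-≥ k a b) p h′))

  μ-continuous : ∀ a → μ a ⊆ (λ p → ∃[ ε ] (0ℚ ℚ.< ε × μ (a -ᴹ (ε *ₗ 1ᴿ)) p))
  μ-continuous a p (n , Lp) =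
    let q , p<q , Lq          = to (L-rounded (I (trunc n a)) p) Lp
        ε , 0<ε , p+nε≤q      = ∃-ℕ-multiple-below n p<q
        0≤nε                  = 0≤ℕ→ℚ* n (ℚ.<⇒≤ 0<ε)
        W                     = trunc n (a -ᴹ (ε *ₗ 1ᴿ))
        r , s , Lr , Ls , q<r+s = to (additive W ((ℕ→ℚ n ℚ.* ε) *ₗ 1ᴿ) q)
                                    (LI-mono (trunc-≤-shift n a (ℚ.<⇒≤ 0<ε)) q Lq)
        p<r = +-cancelʳ-< (ℕ→ℚ n ℚ.* ε) (begin-strict
                p ℚ.+ ℕ→ℚ n ℚ.* ε   ≤⟨ p+nε≤q ⟩
                q                   <⟨ q<r+s ⟩
                r ℚ.+ s             <⟨ ℚ.+-monoʳ-< r (LI[q·1]<q 0≤nε Ls) ⟩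
                r ℚ.+ ℕ→ℚ n ℚ.* ε   ∎)
    in ε , 0<ε , n , L-downClosed-< (I W) p<r Lr
    where open ℚ.≤-Reasoning

  valuation : Valuation R
  valuation = record
    { μ          = λ t → μ-lowerReal ⟦ t ⟧
    ; nonneg     = λ t → μ-nonneg ⟦ t ⟧
    ; μ-⊥        = μ-0
    ; μ-⊤        = μ-1
    ; modular    = λ s t → μ-modular ⟦ s ⟧ ⟦ t ⟧
    ; monotone   = λ s⊑t → μ-mono (⟦⟧-mono s⊑t)
    ; continuous = μ-continuous
    }

lemma4p16 : {c ℓ₁ ℓ₂ : Level} (R : RieszSpace c ℓ₁ ℓ₂) (𝓘 : Integral R)
    → Σ[ ν ∈ Valuation R ] (∀ a → cut (Valuation.μ ν (D a)) ≐ μI R 𝓘 a)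
lemma4p16 R 𝓘 = valuation , λ a p → mk⇔ id id
  where open IntegralProperties 𝓘
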